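{- Let $S$ be a finite nonempty set of positive integers, set $s=\max S$, and let $r\ge1$ be an integer. The minimum density of an $r$-identifying code in $G(S)$ is achieved by a periodic set with period at most $(6sr)2^{6sr}$: there exists a periodic $r$-identifying code $A$ with period at most $(6sr)2^{6sr}$ such that $\delta(A)\le\delta(A')$ for every $r$-identifying code $A'$ of $G(S)$.
   Context: The distance graph $G(S)$ has vertex set $\mathbb{Z}$, with $i,j$ adjacent iff $|i-j|\in S$. The ball $B_r(u)$ of radius $r$ centered at $u$ is the set of vertices at graph distance at most $r$ from $u$ in $G(S)$. A set $A\subseteq\mathbb{Z}$ is an $r$-identifying code if for every pair of distinct vertices $u,v$, the sets $A\cap B_r(u)$ and $A\cap B_r(v)$ are nonempty and distinct. The density of $A$ is $\delta(A)=\limsup_{N\to\infty}\frac{|A\cap[-N,N]|}{2N+1}$. A set $A$ is periodic with period $p\ge1$ if $A+p=A$. -}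

module Defs where

open import Data.Nat as ℕ using (ℕ; zero; suc; _⊔_)
open import Data.Integer as ℤ using (ℤ; +_; ∣_∣; _-_)
open import Data.Rational as ℚ using (ℚ; _/_)
open import Data.Bool using (Bool; true; false; if_then_else_)
open import Data.List using (List; []; _∷_; foldr; map; upTo)
open import Data.Nat.ListAction using (sum)
open import Data.List.Membership.Propositional using (_∈_)
open import Data.Product using (Σ; ∃; _×_)
open import Relation.Binary.PropositionalEquality using (_≡_; _≢_)
open import Relation.Nullary using (¬_)
open import Function.Bundles using (_⇔_)

Adj : List ℕ → ℤ → ℤ → Set
Adj S i j = ∣ i - j ∣ ∈ S

-- Within S r u w : there is a walk of length at most r from u to w in G(S),
-- i.e. the graph distance from u to w is at most r.
data Within (S : List ℕ) : ℕ → ℤ → ℤ → Set where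
  here  : ∀ {r u} → Within S r u u
  there : ∀ {r u v w} → Within S r u v → Adj S v w → Within S (suc r) u w

Ball : List ℕ → ℕ → ℤ → ℤ → Set
Ball S r u w = Within S r u w

Subset : Set
Subset = ℤ → Bool

InCodeBall : List ℕ → ℕ → Subset → ℤ → ℤ → Set
InCodeBall S r A u w = (A w ≡ true) × Ball S r u w

IsIdCode : List ℕ → ℕ → Subset → Set
IsIdCode S r A =
  (∀ u → ∃ λ w → InCodeBall S r A u w) ×
  (∀ u v → u ≢ v → ¬ (∀ w → InCodeBall S r A u w ⇔ InCodeBall S r A v w))

IsPeriodic : Subset → ℕ → Set
IsPeriodic A p = (1 ℕ.≤ p) × (∀ i → A (i ℤ.+ + p) ≡ A i)

count : Subset → ℕ → ℕ
count A N = sum (map (λ k → if A (+ k - + N) then 1 else 0) (upTo (suc (N ℕ.+ N))))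

densitySeq : Subset → ℕ → ℚ
densitySeq A N = (+ count A N) / suc (N ℕ.+ N)

-- δ(A) ≤ δ(B), where δ = limsup of densitySeq, unfolded:
-- for every ε = 1/(k+1) there is N₀ such that for all n ≥ N₀ and all M
-- there is m ≥ M with densitySeq A n ≤ densitySeq B m + ε.
DensityLe : Subset → Subset → Set
DensityLe A B =
  ∀ (k : ℕ) → ∃ λ N₀ → ∀ n → N₀ ℕ.≤ n → ∀ M → ∃ λ m → (M ℕ.≤ m) ×
    (densitySeq A n ℚ.≤ densitySeq B m ℚ.+ (+ 1 / suc k))

maxList : List ℕ → ℕ
maxList = foldr _⊔_ 0

AllPos : List ℕ → Set
AllPos S = ∀ {x} → x ∈ S → 1 ℕ.≤ x

-- With R = r · max S, being an r-identifying code is a local property: each window of length 4R + 1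
-- must contain a code point near its centre and, for each of the next 2R vertices, a code point in
-- exactly one of the two balls. So identifying codes are the bi-infinite 0-1 words all of whose windows
-- of a fixed length W + 1 are allowed. Among allowed periodic words of period at most K = 2^W pick one
-- of least density C/Q. An allowed word of length n > K repeats a state (a subword of length W) among
-- its first K + 1 positions; the stretch between the two occurrences repeats to an allowed periodic word
-- of period at most K, so it has density at least C/Q, and excising it leaves an allowed word. By
-- induction every allowed word of length n has at least (C n − C K)/Q ones, so no identifying code is
-- sparser than the optimal periodic one.

module Submission where

open import Defs
open import Data.Bool using (Bool; true; false; if_then_else_)
import Data.Bool.Properties as Bool
open import Data.Empty using (⊥-elim)
open import Data.Fin using (Fin; toℕ; fromℕ<; finToFun; funToFin)
open import Data.Fin.Properties
  using (2↔Bool; finToFun-funToFin; toℕ-fromℕ<; fromℕ<-cong; toℕ<n; toℕ≤pred[n]; any?; all?; pigeonhole)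
open import Data.Integer using (ℤ; +_; -[1+_]; ∣_∣; _-_)
import Data.Integer as ℤ
import Data.Integer.Properties as ℤ
open import Data.Integer.Tactic.RingSolver renaming (solve-∀ to ℤ-solve-∀)
open import Data.List using (List; []; _∷_; map; applyUpTo; filter; cartesianProduct; allFin)
open import Data.List.Membership.Propositional using (_∈_; find; lose)
open import Data.List.Membership.Propositional.Properties using (∈-cartesianProduct⁺; ∈-allFin; ∈-filter⁺)
open import Data.List.Relation.Unary.Any as Any using (Any; here; there)
import Data.List.Relation.Unary.All as All
open import Data.List.Relation.Unary.All.Properties using (all-filter)
open import Data.Nat as ℕ
  using (ℕ; zero; suc; _+_; _*_; _∸_; _^_; _≤_; _<_; _≤?_; _<?_; z≤n; s≤s; z<s; s<s; NonZero; _/_; _%_)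
open import Data.Nat.DivMod using (m≡m%n+[m/n]*n; m%n<n; m/n*n≤m; [m+kn]%n≡m%n; [m+n]%n≡m%n; m<n⇒m%n≡m)
open import Data.Nat.Induction using (<-rec)
open import Data.Nat.ListAction using (sum)
open import Data.Nat.Properties
open import Data.Nat.Tactic.RingSolver using (solve-∀)
open import Data.Product using (∃; _×_; _,_; proj₁; proj₂)
import Data.Rational as ℚ
import Data.Rational.Properties as ℚ
import Data.Rational.Unnormalised as ℚᵘ
import Data.Rational.Unnormalised.Properties as ℚᵘ
open import Data.Sum using (_⊎_; inj₁; inj₂; [_,_]′)
open import Function using (_∘_; Inverse)
open import Function.Bundles using (_⇔_; mk⇔; Equivalence)
import Function.Properties.Equivalence as ⇔
open import Relation.Binary.PropositionalEquality
open import Relation.Nullary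
  using (Dec; yes; no; ¬_; contradiction; map′; _×-dec_; _⊎-dec_; _→-dec_; ¬?; decidable-stable)

shift : (ℕ → Bool) → ℕ → ℕ → Bool
shift g a t = g (a + t)

ones : (ℕ → Bool) → ℕ → ℕ
ones g zero    = 0
ones g (suc n) = (if g 0 then 1 else 0) + ones (shift g 1) n

ones-cong : ∀ {g h} n → (∀ t → t < n → g t ≡ h t) → ones g n ≡ ones h n
ones-cong zero    g≡h = refl
ones-cong (suc n) g≡h =
  cong₂ (λ b k → (if b then 1 else 0) + k) (g≡h 0 z<s) (ones-cong n (λ t t<n → g≡h (suc t) (s<s t<n)))

ones-+ : ∀ g m n → ones g (m + n) ≡ ones g m + ones (shift g m) n
ones-+ g zero    n = refl
ones-+ g (suc m) n =
  trans (cong (λ k → _ + k) (ones-+ (shift g 1) m n)) (sym (+-assoc (if g 0 then 1 else 0) _ _))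

ones≤ : ∀ g n → ones g n ≤ n
ones≤ g zero    = z≤n
ones≤ g (suc n) = +-mono-≤ (indicator≤1 (g 0)) (ones≤ (shift g 1) n)
  where
  indicator≤1 : ∀ b → (if b then 1 else 0) ≤ 1
  indicator≤1 true  = ≤-refl
  indicator≤1 false = z≤n

ones-mono : ∀ g {m n} → m ≤ n → ones g m ≤ ones g n
ones-mono g {m} {n} m≤n = begin
  ones g m                              ≤⟨ m≤m+n _ _ ⟩
  ones g m + ones (shift g m) (n ∸ m) ≡⟨ ones-+ g m _ ⟨
  ones g (m + (n ∸ m))                ≡⟨ cong (ones g) (m+[n∸m]≡n m≤n) ⟩
  ones g n                              ∎
  where open ≤-Reasoning

count≡ones : ∀ A N → count A N ≡ ones (λ k → A (+ k - + N)) (suc (N + N))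
count≡ones A N = go (λ k → k) (suc (N + N))
  where
  go : ∀ f n → sum (map (λ k → if A (+ k - + N) then 1 else 0) (applyUpTo f n)) ≡
               ones (λ k → A (+ f k - + N)) n
  go f zero    = refl
  go f (suc n) = cong (λ k → _ + k) (go (λ k → f (suc k)) n)

module Periodic (g : ℕ → Bool) (p : ℕ) .{{_ : NonZero p}} (g-periodic : ∀ t → g (t + p) ≡ g t) where

  shift-period : ∀ t → shift g p t ≡ g t
  shift-period t = trans (cong g (+-comm p t)) (g-periodic t)

  ones-* : ∀ k → ones g (k * p) ≡ k * ones g p
  ones-* zero    = refl
  ones-* (suc k) = begin
    ones g (p + k * p)                  ≡⟨ ones-+ g p (k * p) ⟩
    ones g p + ones (shift g p) (k * p) ≡⟨ cong (λ n → ones g p + n) (ones-cong (k * p) (λ t _ → shift-period t)) ⟩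
    ones g p + ones g (k * p)           ≡⟨ cong (λ n → ones g p + n) (ones-* k) ⟩
    ones g p + k * ones g p             ∎
    where open ≡-Reasoning

  ones-shift : ∀ a → ones (shift g a) p ≡ ones g p
  ones-shift a = +-cancelˡ-≡ (ones g a) _ _ (begin
    ones g a + ones (shift g a) p ≡⟨ ones-+ g a p ⟨
    ones g (a + p)                ≡⟨ cong (ones g) (+-comm a p) ⟩
    ones g (p + a)                ≡⟨ ones-+ g p a ⟩
    ones g p + ones (shift g p) a ≡⟨ cong (λ n → ones g p + n) (ones-cong a (λ t _ → shift-period t)) ⟩
    ones g p + ones g a           ≡⟨ +-comm (ones g p) _ ⟩
    ones g a + ones g p           ∎)
    where open ≡-Reasoning

  -- n is covered by ⌊n/p⌋ + 1 full periods.
  period*ones≤ : ∀ n → p * ones g n ≤ ones g p * (n + p)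
  period*ones≤ n = begin
    p * ones g n                  ≤⟨ *-monoʳ-≤ p (ones-mono g n≤kp) ⟩
    p * ones g (k * p)            ≡⟨ cong (p *_) (ones-* k) ⟩
    p * (k * ones g p)            ≡⟨ rearrange p (n / p) (ones g p) ⟩
    ones g p * ((n / p) * p + p)  ≤⟨ *-monoʳ-≤ (ones g p) (+-monoˡ-≤ p (m/n*n≤m n p)) ⟩
    ones g p * (n + p)            ∎
    where
    open ≤-Reasoning
    k : ℕ
    k = suc (n / p)
    rearrange : ∀ p q c → p * (suc q * c) ≡ c * (q * p + p)
    rearrange = solve-∀
    n≤kp : n ≤ k * p
    n≤kp = begin
      n                   ≡⟨ m≡m%n+[m/n]*n n p ⟩
      n % p + (n / p) * p ≤⟨ +-monoˡ-≤ _ (<⇒≤ (m%n<n n p)) ⟩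
      p + (n / p) * p     ∎

bits : ∀ {n} → Fin (2 ^ n) → Fin n → Bool
bits c = Inverse.to 2↔Bool ∘ finToFun c

encode : ∀ {n} → (Fin n → Bool) → Fin (2 ^ n)
encode b = funToFin (Inverse.from 2↔Bool ∘ b)

bits-encode : ∀ {n} (b : Fin n → Bool) k → bits (encode b) k ≡ b k
bits-encode b k =
  trans (cong (Inverse.to 2↔Bool) (finToFun-funToFin _ k)) (Inverse.strictlyInverseˡ 2↔Bool (b k))

mkℚᵘ-≤⇒ : ∀ {a b m n} → ℚᵘ.mkℚᵘ (+ a) m ℚᵘ.≤ ℚᵘ.mkℚᵘ (+ b) n → a * suc n ≤ b * suc m
mkℚᵘ-≤⇒ {a} {b} {m} {n} (ℚᵘ.*≤* cross) =
  ℤ.drop‿+≤+ (subst₂ ℤ._≤_ (sym (ℤ.pos-* a (suc n))) (sym (ℤ.pos-* b (suc m))) cross)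

+-right-comm : ∀ m n o → m + n + o ≡ m + o + n
+-right-comm = solve-∀

%-shift : ∀ x t p .{{_ : NonZero p}} → (x % p + t) % p ≡ (x + t) % p
%-shift x t p = begin
  (x % p + t) % p               ≡⟨ [m+kn]%n≡m%n (x % p + t) (x / p) p ⟨
  (x % p + t + (x / p) * p) % p ≡⟨ cong (_% p) (+-right-comm (x % p) t ((x / p) * p)) ⟩
  (x % p + (x / p) * p + t) % p ≡⟨ cong (λ y → (y + t) % p) (m≡m%n+[m/n]*n x p) ⟨
  (x + t) % p                   ∎
  where open ≡-Reasoning

prefix-periodic : ∀ (h : ℕ → Bool) p .{{_ : NonZero p}} w → (∀ k → k < w → h k ≡ h (p + k)) →
                  ∀ y → y < p + w → h y ≡ h (y % p)
prefix-periodic h p w repeat = <-rec _ step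
  where
  step : ∀ y → (∀ {z} → z < y → z < p + w → h z ≡ h (z % p)) → y < p + w → h y ≡ h (y % p)
  step y rec y<p+w with y <? p
  ... | yes y<p = cong h (sym (m<n⇒m%n≡m y<p))
  ... | no y≮p = begin
    h y             ≡⟨ cong h y≡p+k ⟩
    h (p + k)       ≡⟨ repeat k k<w ⟨
    h k             ≡⟨ rec k<y (<-≤-trans k<w (m≤n+m w p)) ⟩
    h (k % p)       ≡⟨ cong h ([m+n]%n≡m%n k p) ⟨
    h ((k + p) % p) ≡⟨ cong (λ z → h (z % p)) (trans (+-comm k p) (sym y≡p+k)) ⟩
    h (y % p)       ∎
    where
    open ≡-Reasoning
    k : ℕ
    k = y ∸ p
    y≡p+k : y ≡ p + k
    y≡p+k = sym (m+[n∸m]≡n (≮⇒≥ y≮p))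
    k<w : k < w
    k<w = +-cancelˡ-< p k w (subst (_< p + w) y≡p+k y<p+w)
    k<y : k < y
    k<y = subst (k <_) (sym y≡p+k) (m<n+m k (ℕ.>-nonZero⁻¹ p))

module MinimumDensity
  (W : ℕ)
  (Local : (ℕ → Bool) → Set)
  (local? : ∀ g → Dec (Local g))
  (Local-resp : ∀ {g h} → (∀ t → t ≤ W → g t ≡ h t) → Local g → Local h)
  (Local-all-true : Local (λ _ → true))
  where

  Valid : (ℕ → Bool) → Set
  Valid g = ∀ x → Local (shift g x)

  K : ℕ
  K = 2 ^ W

  -- A candidate (q , c) is the sequence of period toℕ q + 1 whose first period is read off the bits of c.
  Candidate : Set
  Candidate = Fin K × Fin (2 ^ K)

  period : Candidate → ℕ
  period c = suc (toℕ (proj₁ c))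

  period≤K : ∀ c → period c ≤ K
  period≤K c = toℕ<n (proj₁ c)

  sequence : Candidate → ℕ → Bool
  sequence c t = bits {K} (proj₂ c) (fromℕ< (<-≤-trans (m%n<n t (period c)) (period≤K c)))

  sequence-cong-% : ∀ c a b → a % period c ≡ b % period c → sequence c a ≡ sequence c b
  sequence-cong-% c a b eq = cong (bits {K} (proj₂ c)) (fromℕ<-cong _ _ eq _ _)

  sequence-periodic : ∀ c t → sequence c (t + period c) ≡ sequence c t
  sequence-periodic c t = sequence-cong-% c (t + period c) t ([m+n]%n≡m%n t (period c))

  ValidCandidate : Candidate → Set
  ValidCandidate c = ∀ (x : Fin (period c)) → Local (shift (sequence c) (toℕ x))

  validCandidate? : ∀ c → Dec (ValidCandidate c)
  validCandidate? c = all? (λ x → local? _)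

  ValidCandidate⇒Valid : ∀ c → ValidCandidate c → Valid (sequence c)
  ValidCandidate⇒Valid c valid x = Local-resp agree (valid x%p)
    where
    x%p : Fin (period c)
    x%p = fromℕ< (m%n<n x (period c))
    agree : ∀ t → t ≤ W → sequence c (toℕ x%p + t) ≡ sequence c (x + t)
    agree t _ = sequence-cong-% c (toℕ x%p + t) (x + t)
      (trans (cong (λ y → (y + t) % period c) (toℕ-fromℕ< (m%n<n x (period c)))) (%-shift x t (period c)))

  all-ones : Candidate
  all-ones = fromℕ< (m^n>0 2 W) , encode {K} (λ _ → true)

  all-ones-valid : ValidCandidate all-ones
  all-ones-valid x = Local-resp (λ t _ → sym (bits-encode {K} _ _)) Local-all-true

  density : Candidate → ℚᵘ.ℚᵘ
  density c = ℚᵘ.mkℚᵘ (+ ones (sequence c) (period c)) (toℕ (proj₁ c))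

  candidates : List Candidate
  candidates = cartesianProduct (allFin K) (allFin (2 ^ K))

  open import Data.List.Extrema ℚᵘ.≤-totalOrder using (argmin; argmin-all; f[argmin]≤f[xs])

  best : Candidate
  best = argmin density all-ones (filter validCandidate? candidates)

  best-valid : Valid (sequence best)
  best-valid = ValidCandidate⇒Valid best
    (argmin-all density all-ones-valid (all-filter validCandidate? candidates))

  Q : ℕ
  Q = period best

  C : ℕ
  C = ones (sequence best) Q

  best-optimal : ∀ c → ValidCandidate c → C * period c ≤ ones (sequence c) (period c) * Q
  best-optimal c valid = mkℚᵘ-≤⇒ (All.lookup (f[argmin]≤f[xs] {f = density} all-ones _)
    (∈-filter⁺ validCandidate? (∈-cartesianProduct⁺ (∈-allFin (proj₁ c)) (∈-allFin (proj₂ c))) valid))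

  state : (ℕ → Bool) → ℕ → Fin K
  state f i = encode (λ (k : Fin W) → f (i + toℕ k))

  state-agree : ∀ f {i j} → state f i ≡ state f j → ∀ k → k < W → f (i + k) ≡ f (j + k)
  state-agree f {i} {j} eq k k<W = begin
    f (i + k)                     ≡⟨ cong (λ y → f (i + y)) (toℕ-fromℕ< k<W) ⟨
    f (i + toℕ (fromℕ< k<W))      ≡⟨ bits-encode {W} _ _ ⟨
    bits {W} (state f i) (fromℕ< k<W) ≡⟨ cong (λ c → bits {W} c (fromℕ< k<W)) eq ⟩
    bits {W} (state f j) (fromℕ< k<W) ≡⟨ bits-encode {W} _ _ ⟩
    f (j + toℕ (fromℕ< k<W))      ≡⟨ cong (λ y → f (j + y)) (toℕ-fromℕ< k<W) ⟩
    f (j + k)                     ∎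
    where open ≡-Reasoning

  Repeats : (ℕ → Bool) → ℕ → Fin K → Set
  Repeats f i q = ∀ k → k < W → f (i + k) ≡ f (i + (suc (toℕ q) + k))

  -- The state at i codes f i … f (i + W ∸ 1); the K + 1 states at 0, …, K cannot all differ.
  repeated-state : ∀ f → ∃ λ i → ∃ λ (q : Fin K) → i + suc (toℕ q) ≤ K × Repeats f i q
  repeated-state f with pigeonhole (n<1+n K) (state f ∘ toℕ)
  ... | i , j , i<j , same = toℕ i , q , i+P≤K , agree
    where
    p : ℕ
    p = toℕ j ∸ suc (toℕ i)
    j≤K : toℕ j ≤ K
    j≤K = ℕ.s≤s⁻¹ (toℕ<n j)
    i+1+p≡j : toℕ i + suc p ≡ toℕ j
    i+1+p≡j = trans (+-suc (toℕ i) p) (m+[n∸m]≡n i<j)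
    q : Fin K
    q = fromℕ< (≤-trans (m≤n+m (suc p) (toℕ i)) (subst (_≤ K) (sym i+1+p≡j) j≤K))
    i+P≡j : toℕ i + suc (toℕ q) ≡ toℕ j
    i+P≡j = trans (cong (λ y → toℕ i + suc y) (toℕ-fromℕ< _)) i+1+p≡j
    i+P≤K : toℕ i + suc (toℕ q) ≤ K
    i+P≤K = subst (_≤ K) (sym i+P≡j) j≤K
    agree : Repeats f (toℕ i) q
    agree k k<W = trans (state-agree f same k k<W)
                        (trans (cong (λ y → f (y + k)) (sym i+P≡j)) (cong f (+-assoc (toℕ i) _ k)))

  module Excision (f : ℕ → Bool) (valid : Valid f) (i : ℕ) (q : Fin K) (repeat : Repeats f i q) where

    P : ℕ
    P = suc (toℕ q)

    segment : Candidate
    segment = q , encode (λ (k : Fin K) → f (i + toℕ k))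

    segment-sequence : ∀ t → sequence segment t ≡ f (i + t % P)
    segment-sequence t = trans (bits-encode {K} _ _) (cong (λ y → f (i + y)) (toℕ-fromℕ< _))

    segment-valid : ValidCandidate segment
    segment-valid x = Local-resp agree (valid (i + toℕ x))
      where
      agree : ∀ t → t ≤ W → f (i + toℕ x + t) ≡ sequence segment (toℕ x + t)
      agree t t≤W = begin
        f (i + toℕ x + t)            ≡⟨ cong f (+-assoc i (toℕ x) t) ⟩
        f (i + (toℕ x + t))          ≡⟨ prefix-periodic (shift f i) P W repeat _ (+-mono-<-≤ (toℕ<n x) t≤W) ⟩
        f (i + (toℕ x + t) % P)      ≡⟨ segment-sequence (toℕ x + t) ⟨
        sequence segment (toℕ x + t) ∎
        where open ≡-Reasoning

    ones-segment : ones (sequence segment) P ≡ ones (shift f i) P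
    ones-segment =
      ones-cong P (λ t t<P → trans (segment-sequence t) (cong (λ y → f (i + y)) (m<n⇒m%n≡m t<P)))

    excised : ℕ → Bool
    excised t with t <? i
    ... | yes _ = f t
    ... | no  _ = f (t + P)

    excised-< : ∀ {t} → t < i → excised t ≡ f t
    excised-< {t} t<i with t <? i
    ... | yes _   = refl
    ... | no t≮i = contradiction t<i t≮i

    excised-≥ : ∀ {t} → i ≤ t → excised t ≡ f (t + P)
    excised-≥ {t} i≤t with t <? i
    ... | yes t<i = contradiction t<i (≤⇒≯ i≤t)
    ... | no _    = refl

    excised-near : ∀ {x} → x < i → ∀ t → t ≤ W → excised (x + t) ≡ f (x + t)
    excised-near {x} x<i t t≤W = by-cases (x + t <? i)
      where
      by-cases : Dec (x + t < i) → excised (x + t) ≡ f (x + t)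
      by-cases (yes x+t<i) = excised-< x+t<i
      by-cases (no x+t≮i)  = begin
        excised (x + t) ≡⟨ excised-≥ (≮⇒≥ x+t≮i) ⟩
        f (x + t + P)   ≡⟨ cong (λ y → f (y + P)) i+k≡x+t ⟨
        f (i + k + P)   ≡⟨ cong f (trans (+-assoc i k P) (cong (λ n → i + n) (+-comm k P))) ⟩
        f (i + (P + k)) ≡⟨ repeat k k<W ⟨
        f (i + k)       ≡⟨ cong f i+k≡x+t ⟩
        f (x + t)       ∎
        where
        open ≡-Reasoning
        k : ℕ
        k = x + t ∸ i
        i+k≡x+t : i + k ≡ x + t
        i+k≡x+t = m+[n∸m]≡n (≮⇒≥ x+t≮i)
        k<W : k < W
        k<W = +-cancelˡ-< i k W (subst (_< i + W) (sym i+k≡x+t) (+-mono-<-≤ x<i t≤W))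

    excised-valid : Valid excised
    excised-valid x with x <? i
    ... | yes x<i = Local-resp (λ t t≤W → sym (excised-near x<i t t≤W)) (valid x)
    ... | no x≮i = Local-resp far (valid (x + P))
      where
      far : ∀ t → t ≤ W → f (x + P + t) ≡ excised (x + t)
      far t _ = trans (cong f (+-right-comm x P t)) (sym (excised-≥ (≤-trans (≮⇒≥ x≮i) (m≤m+n x t))))

    ones-excised : ∀ m → ones excised (i + m) ≡ ones f i + ones (shift f (i + P)) m
    ones-excised m = trans (ones-+ excised i m) (cong₂ _+_
      (ones-cong i (λ t → excised-< {t}))
      (ones-cong m (λ t _ → trans (excised-≥ (m≤m+n i t)) (cong f (+-right-comm i t P)))))

    ones-excising : ∀ m → ones f (i + P + m) ≡ ones f i + ones (sequence segment) P + ones (shift f (i + P)) m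
    ones-excising m = begin
      ones f (i + P + m)                   ≡⟨ ones-+ f (i + P) m ⟩
      ones f (i + P) + c                   ≡⟨ cong (_+ c) (ones-+ f i P) ⟩
      ones f i + ones (shift f i) P + c    ≡⟨ cong (λ b → ones f i + b + c) ones-segment ⟨
      ones f i + ones (sequence segment) P + c ∎
      where
      open ≡-Reasoning
      c : ℕ
      c = ones (shift f (i + P)) m

    excision-step : ∀ m → C * (i + m) ≤ Q * ones excised (i + m) + C * K →
                    C * (i + P + m) ≤ Q * ones f (i + P + m) + C * K
    excision-step m ih = begin
      C * (i + P + m)                          ≡⟨ split-P C i P m ⟩
      C * (i + m) + C * P                      ≤⟨ +-mono-≤ ih (best-optimal segment segment-valid) ⟩
      Q * ones excised (i + m) + C * K + b * Q ≡⟨ cong (λ z → Q * z + C * K + b * Q) (ones-excised m) ⟩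
      Q * (a + c) + C * K + b * Q              ≡⟨ collect Q C K a b c ⟩
      Q * (a + b + c) + C * K                  ≡⟨ cong (λ z → Q * z + C * K) (ones-excising m) ⟨
      Q * ones f (i + P + m) + C * K           ∎
      where
      open ≤-Reasoning
      a b c : ℕ
      a = ones f i
      b = ones (sequence segment) P
      c = ones (shift f (i + P)) m
      split-P : ∀ C i P m → C * (i + P + m) ≡ C * (i + m) + C * P
      split-P = solve-∀
      collect : ∀ Q C K a b c → Q * (a + c) + C * K + b * Q ≡ Q * (a + b + c) + C * K
      collect = solve-∀

  -- Excising a repeated stretch of length P costs at least C * P / Q ones, by optimality of the best candidate.
  lower-bound : ∀ n f → Valid f → C * n ≤ Q * ones f n + C * K
  lower-bound = <-rec Bound step
    where
    Bound : ℕ → Set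
    Bound n = ∀ f → Valid f → C * n ≤ Q * ones f n + C * K

    step : ∀ n → (∀ {m} → m < n → Bound m) → Bound n
    step n rec f valid = by-cases (n ≤? K) (repeated-state f)
      where
      by-cases : Dec (n ≤ K) → (∃ λ i → ∃ λ (q : Fin K) → i + suc (toℕ q) ≤ K × Repeats f i q) →
                 C * n ≤ Q * ones f n + C * K
      by-cases (yes n≤K) _ = ≤-trans (*-monoʳ-≤ C n≤K) (m≤n+m (C * K) (Q * ones f n))
      by-cases (no n≰K) (i , q , i+P≤K , repeat) =
        subst (λ n → C * n ≤ Q * ones f n + C * K) i+P+m≡n
              (excision-step m (rec i+m<n excised excised-valid))
        where
        open Excision f valid i q repeat
        m : ℕ
        m = n ∸ (i + P)
        i+P+m≡n : i + P + m ≡ n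
        i+P+m≡n = m+[n∸m]≡n (≤-trans i+P≤K (<⇒≤ (≰⇒> n≰K)))
        i+m<n : i + m < n
        i+m<n = subst (i + m <_) i+P+m≡n (+-monoˡ-< m (m<m+n i z<s))

module IntegerExtension
  (g : ℕ → Bool) (p : ℕ) .{{_ : NonZero p}} (g-periodic : ∀ t → g (t + p) ≡ g t)
  where

  g-periodic* : ∀ k t → g (t + k * p) ≡ g t
  g-periodic* zero    t = cong g (+-identityʳ t)
  g-periodic* (suc k) t = begin
    g (t + (p + k * p)) ≡⟨ cong g (+-assoc t p (k * p)) ⟨
    g (t + p + k * p)   ≡⟨ cong g (+-right-comm t p (k * p)) ⟩
    g (t + k * p + p)   ≡⟨ g-periodic (t + k * p) ⟩
    g (t + k * p)       ≡⟨ g-periodic* k t ⟩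
    g t                 ∎
    where open ≡-Reasoning

  representative-step : ∀ i k k′ {a b} → i ℤ.+ + (k * p) ≡ + a → i ℤ.+ + (k′ * p) ≡ + b → k ≤ k′ → g b ≡ g a
  representative-step i k k′ {a} {b} i+kp≡a i+k′p≡b k≤k′ = trans (cong g b≡) (g-periodic* (k′ ∸ k) a)
    where
    b≡ : b ≡ a + (k′ ∸ k) * p
    b≡ = ℤ.+-injective (begin
      + b                                     ≡⟨ i+k′p≡b ⟨
      i ℤ.+ + (k′ * p)                        ≡⟨ cong (λ n → i ℤ.+ + (n * p)) (m+[n∸m]≡n k≤k′) ⟨
      i ℤ.+ + ((k + (k′ ∸ k)) * p)            ≡⟨ cong (λ n → i ℤ.+ + n) (*-distribʳ-+ p k (k′ ∸ k)) ⟩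
      i ℤ.+ + (k * p + (k′ ∸ k) * p)          ≡⟨ cong (λ n → i ℤ.+ n) (ℤ.pos-+ (k * p) _) ⟩
      i ℤ.+ (+ (k * p) ℤ.+ + ((k′ ∸ k) * p))  ≡⟨ ℤ.+-assoc i _ _ ⟨
      (i ℤ.+ + (k * p)) ℤ.+ + ((k′ ∸ k) * p)  ≡⟨ cong (ℤ._+ + ((k′ ∸ k) * p)) i+kp≡a ⟩
      + a ℤ.+ + ((k′ ∸ k) * p)                ≡⟨ ℤ.pos-+ a _ ⟨
      + (a + (k′ ∸ k) * p)                    ∎)
      where open ≡-Reasoning

  representatives-agree : ∀ i k k′ {a b} → i ℤ.+ + (k * p) ≡ + a → i ℤ.+ + (k′ * p) ≡ + b → g a ≡ g b
  representatives-agree i k k′ i+kp≡a i+k′p≡b with ≤-total k k′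
  ... | inj₁ k≤k′ = sym (representative-step i k k′ i+kp≡a i+k′p≡b k≤k′)
  ... | inj₂ k′≤k = representative-step i k′ k i+k′p≡b i+kp≡a k′≤k

  -- The second clause is -[1+ n ] + (n + 1) * p.
  residue : ℤ → ℕ
  residue (+ n)    = n
  residue -[1+ n ] = suc n * p ∸ suc n

  residue-representative : ∀ i → ∃ λ k → i ℤ.+ + (k * p) ≡ + residue i
  residue-representative (+ n)    = 0 , ℤ.+-identityʳ (+ n)
  residue-representative -[1+ n ] = suc n , ℤ.⊖-≥ (m≤m*n (suc n) p)

  extend : ℤ → Bool
  extend i = g (residue i)

  extend-window : ∀ x t → extend (x ℤ.+ + t) ≡ g (residue x + t)
  extend-window x t with residue-representative x | residue-representative (x ℤ.+ + t)
  ... | k , x+kp≡ | k′ , rep′ = representatives-agree (x ℤ.+ + t) k′ k rep′ shifted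
    where
    swap : ∀ x t c → (x ℤ.+ t) ℤ.+ c ≡ (x ℤ.+ c) ℤ.+ t
    swap = ℤ-solve-∀
    shifted : (x ℤ.+ + t) ℤ.+ + (k * p) ≡ + (residue x + t)
    shifted = trans (swap x (+ t) (+ (k * p))) (trans (cong (ℤ._+ + t) x+kp≡) (sym (ℤ.pos-+ (residue x) t)))

  extend-periodic : ∀ i → extend (i ℤ.+ + p) ≡ extend i
  extend-periodic i with residue-representative i | residue-representative (i ℤ.+ + p)
  ... | k , i+kp≡ | k′ , i+p+k′p≡ = representatives-agree i (suc k′) k one-more i+kp≡
    where
    one-more : i ℤ.+ + (suc k′ * p) ≡ + residue (i ℤ.+ + p)
    one-more = trans (cong (λ n → i ℤ.+ n) (ℤ.pos-+ p (k′ * p))) (trans (sym (ℤ.+-assoc i (+ p) _)) i+p+k′p≡)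

  count-extend≤ : ∀ N → p * count extend N ≤ ones g p * (suc (N + N) + p)
  count-extend≤ N = begin
    p * count extend N                   ≡⟨ cong (p *_) (count≡ones extend N) ⟩
    p * ones (λ k → extend (+ k - + N)) L ≡⟨ cong (p *_) (ones-cong L (λ k _ → window k)) ⟩
    p * ones (shift g a) L               ≤⟨ period*ones≤ L ⟩
    ones (shift g a) p * (L + p)         ≡⟨ cong (_* (L + p)) (Periodic.ones-shift g p g-periodic a) ⟩
    ones g p * (L + p)                   ∎
    where
    open ≤-Reasoning
    L a : ℕ
    L = suc (N + N)
    a = residue (ℤ.- + N)
    window : ∀ k → extend (+ k - + N) ≡ shift g a k
    window k = trans (cong extend (ℤ.+-comm (+ k) (ℤ.- + N))) (extend-window (ℤ.- + N) k)
    shift-periodic : ∀ t → shift g a (t + p) ≡ shift g a t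
    shift-periodic t = trans (cong g (sym (+-assoc a t p))) (g-periodic (a + t))
    open Periodic (shift g a) p shift-periodic using (period*ones≤)

∈⇒≤maxList : ∀ {x} S → x ∈ S → x ≤ maxList S
∈⇒≤maxList (y ∷ S) (here refl) = m≤m⊔n y _
∈⇒≤maxList (y ∷ S) (there x∈S) = ≤-trans (∈⇒≤maxList S x∈S) (m≤n⊔m y _)

maxList∈ : ∀ S → S ≢ [] → maxList S ∈ S
maxList∈ []          S≢[] = ⊥-elim (S≢[] refl)
maxList∈ (y ∷ [])    _    = here (⊔-identityʳ y)
maxList∈ (y ∷ z ∷ S) _    =
  [ here , (λ y⊔m≡m → there (subst (_∈ z ∷ S) (sym y⊔m≡m) (maxList∈ (z ∷ S) λ ()))) ]′
  (⊔-sel y (maxList (z ∷ S)))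

∣[i+j]-i∣≡∣j∣ : ∀ i j → ∣ (i ℤ.+ j) - i ∣ ≡ ∣ j ∣
∣[i+j]-i∣≡∣j∣ i j = cong ∣_∣ (cancel i j)
  where
  cancel : ∀ i j → (i ℤ.+ j) - i ≡ j
  cancel = ℤ-solve-∀

module DistanceGraph (S : List ℕ) where

  Within-shift : ∀ {r u w} k → Within S r u w → Within S r (u ℤ.+ k) (w ℤ.+ k)
  Within-shift k here                                  = here
  Within-shift k (there {v = v} {w = w} u~v |v-w|∈S) =
    there (Within-shift k u~v) (subst (_∈ S) (cong ∣_∣ (cancel v w k)) |v-w|∈S)
    where
    cancel : ∀ v w k → v - w ≡ (v ℤ.+ k) - (w ℤ.+ k)
    cancel = ℤ-solve-∀

  Within-translate : ∀ {r u w} k → Within S r u w ⇔ Within S r (k ℤ.+ u) (k ℤ.+ w)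
  Within-translate {r} {u} {w} k = mk⇔
    (subst₂ (Within S r) (ℤ.+-comm u k) (ℤ.+-comm w k) ∘ Within-shift k)
    (subst₂ (Within S r) (back k u) (back k w) ∘ Within-shift (ℤ.- k))
    where
    back : ∀ k x → (k ℤ.+ x) ℤ.+ ℤ.- k ≡ x
    back = ℤ-solve-∀

  Within⇒dist≤ : ∀ {r u w} → Within S r u w → ∣ w - u ∣ ≤ maxList S * r
  Within⇒dist≤ {u = u} here = subst (_≤ _) (sym (cong ∣_∣ (ℤ.+-inverseʳ u))) z≤n
  Within⇒dist≤ {suc r} {u} {w} (there {v = v} u~v |v-w|∈S) = begin
    ∣ w - u ∣               ≡⟨ cong ∣_∣ (telescope w v u) ⟩
    ∣ (w - v) ℤ.+ (v - u) ∣ ≤⟨ ℤ.∣i+j∣≤∣i∣+∣j∣ (w - v) (v - u) ⟩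
    ∣ w - v ∣ ℕ.+ ∣ v - u ∣ ≤⟨ +-mono-≤ step (Within⇒dist≤ u~v) ⟩
    maxList S ℕ.+ maxList S * r ≡⟨ *-suc (maxList S) r ⟨
    maxList S * suc r       ∎
    where
    open ≤-Reasoning
    telescope : ∀ w v u → w - u ≡ (w - v) ℤ.+ (v - u)
    telescope = ℤ-solve-∀
    step : ∣ w - v ∣ ≤ maxList S
    step = subst (_≤ maxList S) (ℤ.∣i-j∣≡∣j-i∣ v w) (∈⇒≤maxList S |v-w|∈S)


  within? : ∀ r u w → Dec (Within S r u w)
  within? zero    u w = map′ (λ { refl → here }) (λ { here → refl }) (u ℤ.≟ w)
  within? (suc r) u w with u ℤ.≟ w
  ... | yes refl = yes here
  ... | no u≢w   = map′ from-neighbour to-neighbour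
                     (Any.any? (λ x → within? r u (w ℤ.+ + x) ⊎-dec within? r u (w - + x)) S)
    where
    Neighbour : ℕ → Set
    Neighbour x = Within S r u (w ℤ.+ + x) ⊎ Within S r u (w - + x)

    from-neighbour : Any Neighbour S → Within S (suc r) u w
    from-neighbour any with find any
    ... | x , x∈S , inj₁ u~w+x = there u~w+x (subst (_∈ S) (sym (∣[i+j]-i∣≡∣j∣ w (+ x))) x∈S)
    ... | x , x∈S , inj₂ u~w-x =
      there u~w-x (subst (_∈ S) (sym (trans (∣[i+j]-i∣≡∣j∣ w (ℤ.- + x)) (ℤ.∣-i∣≡∣i∣ (+ x)))) x∈S)

    to-neighbour : Within S (suc r) u w → Any Neighbour S
    to-neighbour here = ⊥-elim (u≢w refl)
    to-neighbour (there {v = v} u~v |v-w|∈S) = lose |v-w|∈S (neighbour (ℤ.+∣i∣≡i⊎+∣i∣≡-i (v - w)))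
      where
      split : ∀ v w → v ≡ w ℤ.+ (v - w)
      split = ℤ-solve-∀
      neighbour : (+ ∣ v - w ∣ ≡ v - w) ⊎ (+ ∣ v - w ∣ ≡ ℤ.- (v - w)) → Neighbour ∣ v - w ∣
      neighbour (inj₁ eq) = inj₁ (subst (Within S r u) (trans (split v w) (cong (λ d → w ℤ.+ d) (sym eq))) u~v)
      neighbour (inj₂ eq) = inj₂ (subst (Within S r u) (trans (split v w) (cong (λ d → w ℤ.+ d) v-w≡)) u~v)
        where
        v-w≡ : v - w ≡ ℤ.- + ∣ v - w ∣
        v-w≡ = trans (sym (ℤ.neg-involutive (v - w))) (cong ℤ.-_ (sym eq))

  Within-maxList* : maxList S ∈ S → ∀ r u → Within S r u (u ℤ.+ + (maxList S * r))
  Within-maxList* s∈S zero u =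
    subst (Within S 0 u) (sym (trans (cong (λ n → u ℤ.+ + n) (*-zeroʳ (maxList S))) (ℤ.+-identityʳ u))) here
  Within-maxList* s∈S (suc r) u =
    subst (Within S (suc r) u) (sym next≡) (there (Within-maxList* s∈S r u) (subst (_∈ S) (sym step) s∈S))
    where
    s : ℕ
    s = maxList S
    x : ℤ
    x = u ℤ.+ + (s * r)
    reassoc : ∀ u a b → u ℤ.+ (a ℤ.+ b) ≡ (u ℤ.+ b) ℤ.+ a
    reassoc = ℤ-solve-∀
    next≡ : u ℤ.+ + (s * suc r) ≡ x ℤ.+ + s
    next≡ = trans (cong (λ n → u ℤ.+ + n) (*-suc s r))
              (trans (cong (λ d → u ℤ.+ d) (ℤ.pos-+ s (s * r))) (reassoc u (+ s) (+ (s * r))))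
    step : ∣ x - (x ℤ.+ + s) ∣ ≡ s
    step = trans (ℤ.∣i-j∣≡∣j-i∣ x _) (∣[i+j]-i∣≡∣j∣ x (+ s))

  common-point⇒dist≤ : ∀ {r u v w} → Within S r u w → Within S r v w →
                       ∣ v - u ∣ ≤ maxList S * r + maxList S * r
  common-point⇒dist≤ {r} {u} {v} {w} u~w v~w = begin
    ∣ v - u ∣               ≡⟨ cong ∣_∣ (telescope v w u) ⟩
    ∣ (v - w) ℤ.+ (w - u) ∣ ≤⟨ ℤ.∣i+j∣≤∣i∣+∣j∣ (v - w) (w - u) ⟩
    ∣ v - w ∣ + ∣ w - u ∣   ≤⟨ +-mono-≤ (subst (_≤ _) (ℤ.∣i-j∣≡∣j-i∣ w v) (Within⇒dist≤ v~w)) (Within⇒dist≤ u~w) ⟩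
    maxList S * r + maxList S * r ∎
    where
    open ≤-Reasoning
    telescope : ∀ v w u → v - u ≡ (v - w) ℤ.+ (w - u)
    telescope = ℤ-solve-∀

_⇔?_ : ∀ {a b} {A : Set a} {B : Set b} → Dec A → Dec B → Dec (A ⇔ B)
a? ⇔? b? =
  map′ (λ (f , g) → mk⇔ f g) (λ e → Equivalence.to e , Equivalence.from e) ((a? →-dec b?) ×-dec (b? →-dec a?))

≢⇒apart : ∀ {u v} → u ≢ v → ∃ λ d → (v ≡ u ℤ.+ + suc d) ⊎ (u ≡ v ℤ.+ + suc d)
≢⇒apart {u} {v} u≢v = apart (v - u) refl
  where
  split : ∀ u v → v ≡ u ℤ.+ (v - u)
  split = ℤ-solve-∀
  flip : ∀ u v → u ≡ v ℤ.+ ℤ.- (v - u)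
  flip = ℤ-solve-∀
  apart : ∀ δ → v - u ≡ δ → ∃ λ d → (v ≡ u ℤ.+ + suc d) ⊎ (u ≡ v ℤ.+ + suc d)
  apart (+ zero)  eq =
    ⊥-elim (u≢v (sym (trans (split u v) (trans (cong (λ δ → u ℤ.+ δ) eq) (ℤ.+-identityʳ u)))))
  apart (+ suc d) eq = d , inj₁ (trans (split u v) (cong (λ δ → u ℤ.+ δ) eq))
  apart -[1+ d ]  eq = d , inj₂ (trans (flip u v) (cong (λ δ → v ℤ.+ ℤ.- δ) eq))

module Locality (S : List ℕ) (r : ℕ) where

  open DistanceGraph S

  R : ℕ
  R = maxList S * r

  -- Local only inspects offsets up to 4R; the window length 6R is the one of the stated period bound.
  W : ℕ
  W = 6 * maxList S * r

  ≤4R⇒≤W : ∀ {a} → a ≤ R + (R + R + R) → a ≤ W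
  ≤4R⇒≤W a≤4R = ≤-trans a≤4R (subst (R + (R + R + R) ≤_) (sym W≡) (m≤m+n _ (R + R)))
    where
    six : ∀ R → 6 * R ≡ R + (R + R + R) + (R + R)
    six = solve-∀
    W≡ : W ≡ R + (R + R + R) + (R + R)
    W≡ = trans (*-assoc 6 (maxList S) r) (six R)

  InBall : ℕ → ℕ → Set
  InBall c t = Within S r (+ c) (+ t)

  inBall? : ∀ c t → Dec (InBall c t)
  inBall? c t = within? r (+ c) (+ t)

  Separates : ℕ → ℕ → ℕ → Set
  Separates c c′ t = ¬ (InBall c t ⇔ InBall c′ t)

  -- Window positions range over Fin (suc W), so that the quantifiers below are decidable.
  Covers : (ℕ → Bool) → ℕ → Set
  Covers g c = ∃ λ (t : Fin (suc W)) → g (toℕ t) ≡ true × InBall c (toℕ t)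

  Distinguishes : (ℕ → Bool) → ℕ → ℕ → Set
  Distinguishes g c c′ = ∃ λ (t : Fin (suc W)) → g (toℕ t) ≡ true × Separates c c′ (toℕ t)

  -- A window read from x certifies the code conditions at x + R against x + R + 1, …, x + 3R.
  Local : (ℕ → Bool) → Set
  Local g = Covers g R × (∀ (d : Fin (R + R)) → Distinguishes g R (R + suc (toℕ d)))

  covers? : ∀ g c → Dec (Covers g c)
  covers? g c = any? (λ t → (g (toℕ t) Bool.≟ true) ×-dec inBall? c (toℕ t))

  distinguishes? : ∀ g c c′ → Dec (Distinguishes g c c′)
  distinguishes? g c c′ =
    any? (λ t → (g (toℕ t) Bool.≟ true) ×-dec ¬? (inBall? c (toℕ t) ⇔? inBall? c′ (toℕ t)))

  local? : ∀ g → Dec (Local g)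
  local? g = covers? g R ×-dec all? (λ d → distinguishes? g R _)

  Local-resp : ∀ {g h} → (∀ t → t ≤ W → g t ≡ h t) → Local g → Local h
  Local-resp {g} {h} g≡h (covers , distinguishes) =
    move {InBall R} covers , λ d → move {Separates R (R + suc (toℕ d))} (distinguishes d)
    where
    move : ∀ {B : ℕ → Set} → (∃ λ (t : Fin (suc W)) → g (toℕ t) ≡ true × B (toℕ t)) →
           ∃ λ (t : Fin (suc W)) → h (toℕ t) ≡ true × B (toℕ t)
    move (t , gt , b) = t , trans (sym (g≡h (toℕ t) (toℕ≤pred[n] t))) gt , b

  window-point : ∀ {B : ℕ → Set} (g : ℕ → Bool) t → t ≤ W → g t ≡ true → B t →
                 ∃ λ (t′ : Fin (suc W)) → g (toℕ t′) ≡ true × B (toℕ t′)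
  window-point {B} g t t≤W gt b =
    fromℕ< (s≤s t≤W) , subst (λ t → g t ≡ true × B t) (sym (toℕ-fromℕ< _)) (gt , b)

  Local-all-true : maxList S ∈ S → Local (λ _ → true)
  Local-all-true s∈S =
    window-point {InBall R} (λ _ → true) R (≤4R⇒≤W (m≤m+n R _)) refl here ,
    λ d → window-point {Separates R (R + suc (toℕ d))} (λ _ → true) (R + (suc (toℕ d) + R))
            (≤4R⇒≤W (+-monoʳ-≤ R (+-monoˡ-≤ R (toℕ<n d)))) refl (far-point-separates (toℕ d))
    where
    far-point-separates : ∀ e → Separates R (R + suc e) (R + (suc e + R))
    far-point-separates e iff =
      <⇒≱ (m<n+m R z<s) (subst (_≤ R) dist≡ (Within⇒dist≤ (Equivalence.from iff near)))
      where
      near : InBall (R + suc e) (R + (suc e + R))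
      near = subst (Within S r (+ (R + suc e)))
               (trans (sym (ℤ.pos-+ (R + suc e) R)) (cong +_ (+-assoc R (suc e) R)))
               (Within-maxList* s∈S r (+ (R + suc e)))
      dist≡ : ∣ + (R + (suc e + R)) - + R ∣ ≡ suc e + R
      dist≡ = trans (cong (λ z → ∣ z - + R ∣) (ℤ.pos-+ R (suc e + R))) (∣[i+j]-i∣≡∣j∣ (+ R) (+ (suc e + R)))

  window : Subset → ℤ → ℕ → Bool
  window A x t = A (x ℤ.+ + t)

  InBall⇔Within : ∀ x {u} c t → u ≡ x ℤ.+ + c → InBall c t ⇔ Within S r u (x ℤ.+ + t)
  InBall⇔Within x c t refl = Within-translate x

  Within⇒offset : ∀ x c {w} → R ≤ c → Within S r (x ℤ.+ + c) w → ∃ λ t → t ≤ c + R × w ≡ x ℤ.+ + t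
  Within⇒offset x c {w} R≤c x+c~w = offset (w - (x ℤ.+ + c)) (split w (x ℤ.+ + c)) (Within⇒dist≤ x+c~w)
    where
    split : ∀ w u → w ≡ u ℤ.+ (w - u)
    split = ℤ-solve-∀
    offset : ∀ δ → w ≡ (x ℤ.+ + c) ℤ.+ δ → ∣ δ ∣ ≤ R → ∃ λ t → t ≤ c + R × w ≡ x ℤ.+ + t
    offset (+ k)     eq k≤R  = c + k , +-monoʳ-≤ c k≤R ,
      trans eq (trans (ℤ.+-assoc x (+ c) (+ k)) (cong (λ δ → x ℤ.+ δ) (sym (ℤ.pos-+ c k))))
    offset -[1+ k ]  eq k<R  = c ∸ suc k , ≤-trans (m∸n≤m c (suc k)) (m≤m+n c R) ,
      trans eq (trans (ℤ.+-assoc x (+ c) -[1+ k ]) (cong (λ δ → x ℤ.+ δ) (ℤ.⊖-≥ (≤-trans k<R R≤c))))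

  ¬Distinguishes⇒agree : ∀ g c c′ → ¬ Distinguishes g c c′ → ∀ t → t ≤ W → g t ≡ true → InBall c t ⇔ InBall c′ t
  ¬Distinguishes⇒agree g c c′ ¬dist t t≤W gt =
    decidable-stable (inBall? c t ⇔? inBall? c′ t)
                     (λ ¬iff → ¬dist (window-point {Separates c c′} g t t≤W gt ¬iff))

  -- Every code point near the centre x + c lies in the window, where the two balls agree on code points.
  InCodeBall-transfer : ∀ A x c c′ → R ≤ c → c + R ≤ R + (R + R + R) →
                        (∀ t → t ≤ W → A (x ℤ.+ + t) ≡ true → InBall c t ⇔ InBall c′ t) →
                        ∀ w → InCodeBall S r A (x ℤ.+ + c) w → InCodeBall S r A (x ℤ.+ + c′) w
  InCodeBall-transfer A x c c′ R≤c c+R≤4R agree w (Aw , x+c~w) with Within⇒offset x c R≤c x+c~w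
  ... | t , t≤c+R , refl = Aw , Equivalence.to (InBall⇔Within x c′ t refl)
                                  (Equivalence.to (agree t (≤4R⇒≤W (≤-trans t≤c+R c+R≤4R)) Aw)
                                    (Equivalence.from (InBall⇔Within x c t refl) x+c~w))

  SameCodeBall : Subset → ℤ → ℤ → Set
  SameCodeBall A u v = ∀ w → InCodeBall S r A u w ⇔ InCodeBall S r A v w

  IsIdCode⇒Local : ∀ {A} → IsIdCode S r A → ∀ x → Local (window A x)
  IsIdCode⇒Local {A} (covered , separated) x = covers , distinguishes
    where
    R+R≤4R : R + R ≤ R + (R + R + R)
    R+R≤4R = +-monoʳ-≤ R (m≤n+m R (R + R))

    covers : Covers (window A x) R
    covers with covered (x ℤ.+ + R)
    ... | w , Aw , x+R~w with Within⇒offset x R ≤-refl x+R~w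
    ...   | t , t≤R+R , refl = window-point {InBall R} (window A x) t (≤4R⇒≤W (≤-trans t≤R+R R+R≤4R)) Aw
                                 (Equivalence.from (InBall⇔Within x R t refl) x+R~w)

    distinguishes : ∀ d → Distinguishes (window A x) R (R + suc (toℕ d))
    distinguishes d with distinguishes? (window A x) R (R + suc (toℕ d))
    ... | yes dist = dist
    ... | no ¬dist = ⊥-elim (separated (x ℤ.+ + R) (x ℤ.+ + c′) centres-differ same)
      where
      c′ : ℕ
      c′ = R + suc (toℕ d)
      agree : ∀ t → t ≤ W → window A x t ≡ true → InBall R t ⇔ InBall c′ t
      agree = ¬Distinguishes⇒agree (window A x) R c′ ¬dist
      c′+R≤4R : c′ + R ≤ R + (R + R + R)
      c′+R≤4R = subst (_≤ R + (R + R + R)) (sym (+-assoc R (suc (toℕ d)) R))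
                      (+-monoʳ-≤ R (+-monoˡ-≤ R (toℕ<n d)))
      same : SameCodeBall A (x ℤ.+ + R) (x ℤ.+ + c′)
      same w = mk⇔ (InCodeBall-transfer A x R c′ ≤-refl R+R≤4R agree w)
                   (InCodeBall-transfer A x c′ R (m≤m+n R _) c′+R≤4R (λ t t≤W At → ⇔.sym (agree t t≤W At)) w)
      centres-differ : x ℤ.+ + R ≢ x ℤ.+ + c′
      centres-differ eq = m+1+n≰m R (≤-reflexive (begin
        c′                     ≡⟨ ∣[i+j]-i∣≡∣j∣ x (+ c′) ⟨
        ∣ (x ℤ.+ + c′) - x ∣   ≡⟨ cong (λ z → ∣ z - x ∣) eq ⟨
        ∣ (x ℤ.+ + R) - x ∣    ≡⟨ ∣[i+j]-i∣≡∣j∣ x (+ R) ⟩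
        R                      ∎))
        where open ≡-Reasoning

  IsIdCode⇒Local-shifted : ∀ {A} → IsIdCode S r A → ∀ m x → Local (λ t → A (+ (x + t) - + m))
  IsIdCode⇒Local-shifted {A} code m x = Local-resp (λ t _ → cong A (recentre t)) (IsIdCode⇒Local code (+ x - + m))
    where
    swap : ∀ x m t → (x - m) ℤ.+ t ≡ (x ℤ.+ t) - m
    swap = ℤ-solve-∀
    recentre : ∀ t → (+ x - + m) ℤ.+ + t ≡ + (x + t) - + m
    recentre t = trans (swap (+ x) (+ m) (+ t)) (cong (_- + m) (sym (ℤ.pos-+ x t)))

  Local⇒IsIdCode : ∀ {A} → (∀ x → Local (window A x)) → IsIdCode S r A
  Local⇒IsIdCode {A} local = covered , separated
    where
    recentre : ∀ u c → u ℤ.+ + c ≡ (u - + R) ℤ.+ + (R + c)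
    recentre u c = trans (shuffle u (+ R) (+ c)) (cong (λ δ → (u - + R) ℤ.+ δ) (sym (ℤ.pos-+ R c)))
      where
      shuffle : ∀ u a b → u ℤ.+ b ≡ (u - a) ℤ.+ (a ℤ.+ b)
      shuffle = ℤ-solve-∀

    centre : ∀ u → u ≡ (u - + R) ℤ.+ + R
    centre u =
      trans (sym (ℤ.+-identityʳ u)) (trans (recentre u 0) (cong (λ c → (u - + R) ℤ.+ + c) (+-identityʳ R)))

    covered : ∀ u → ∃ λ w → InCodeBall S r A u w
    covered u with proj₁ (local (u - + R))
    ... | t , At , R~t = _ , At , Equivalence.to (InBall⇔Within (u - + R) R (toℕ t) (centre u)) R~t

    code-points : ∀ {u v w} → SameCodeBall A u v → A w ≡ true → Within S r u w ⇔ Within S r v w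
    code-points {w = w} same Aw =
      mk⇔ (λ u~w → proj₂ (Equivalence.to (same w) (Aw , u~w)))
          (λ v~w → proj₂ (Equivalence.from (same w) (Aw , v~w)))

    separated-right : ∀ u d → ¬ SameCodeBall A u (u ℤ.+ + suc d)
    separated-right u d same with suc d ≤? R + R
    ... | yes d<2R with proj₂ (local (u - + R)) (fromℕ< d<2R)
    ...   | t , At , separates = separates (⇔.trans (InBall⇔Within x R _ (centre u))
                                   (⇔.trans (code-points same At) (⇔.sym (InBall⇔Within x _ _ v≡))))
      where
      x : ℤ
      x = u - + R
      v≡ : u ℤ.+ + suc d ≡ x ℤ.+ + (R + suc (toℕ (fromℕ< d<2R)))
      v≡ = trans (recentre u (suc d)) (cong (λ k → x ℤ.+ + (R + suc k)) (sym (toℕ-fromℕ< d<2R)))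
    separated-right u d same | no d≰2R with covered u
    ... | w , Aw , u~w = d≰2R (subst (_≤ R + R) (∣[i+j]-i∣≡∣j∣ u (+ suc d))
                                 (common-point⇒dist≤ u~w (proj₂ (Equivalence.to (same w) (Aw , u~w)))))

    separated : ∀ u v → u ≢ v → ¬ SameCodeBall A u v
    separated u v u≢v same with ≢⇒apart u≢v
    ... | d , inj₁ v≡ = separated-right u d (subst (SameCodeBall A u) v≡ same)
    ... | d , inj₂ u≡ = separated-right v d (λ w → ⇔.sym (subst (λ u → SameCodeBall A u v) u≡ same w))

a/[1+m]≤b/[1+n]+1/[1+k] : ∀ a b m n k → a * (suc n * suc k) ≤ (b * suc k + 1 * suc n) * suc m →
                          + a ℚ./ suc m ℚ.≤ + b ℚ./ suc n ℚ.+ + 1 ℚ./ suc k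
a/[1+m]≤b/[1+n]+1/[1+k] a b m n k cross =
  ℚ.toℚᵘ-cancel-≤ (ℚᵘ.≤-respˡ-≃ (ℚᵘ.≃-sym lhs≃) (ℚᵘ.≤-respʳ-≃ (ℚᵘ.≃-sym rhs≃) unnormalised))
  where
  lhs≃ : ℚ.toℚᵘ (+ a ℚ./ suc m) ℚᵘ.≃ ℚᵘ.mkℚᵘ (+ a) m
  lhs≃ = ℚ.toℚᵘ-fromℚᵘ (ℚᵘ.mkℚᵘ (+ a) m)
  rhs≃ : ℚ.toℚᵘ (+ b ℚ./ suc n ℚ.+ + 1 ℚ./ suc k) ℚᵘ.≃ ℚᵘ.mkℚᵘ (+ b) n ℚᵘ.+ ℚᵘ.mkℚᵘ (+ 1) k
  rhs≃ = ℚᵘ.≃-trans (ℚ.toℚᵘ-homo-+ (+ b ℚ./ suc n) (+ 1 ℚ./ suc k))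
           (ℚᵘ.+-cong (ℚ.toℚᵘ-fromℚᵘ (ℚᵘ.mkℚᵘ (+ b) n)) (ℚ.toℚᵘ-fromℚᵘ (ℚᵘ.mkℚᵘ (+ 1) k)))
  rhs : + ((b * suc k + 1 * suc n) * suc m) ≡ (+ b ℤ.* + suc k ℤ.+ + 1 ℤ.* + suc n) ℤ.* + suc m
  rhs = trans (ℤ.pos-* (b * suc k + 1 * suc n) (suc m)) (cong (ℤ._* + suc m)
          (trans (ℤ.pos-+ (b * suc k) (1 * suc n)) (cong₂ ℤ._+_ (ℤ.pos-* b (suc k)) (ℤ.pos-* 1 (suc n)))))
  unnormalised : ℚᵘ.mkℚᵘ (+ a) m ℚᵘ.≤ ℚᵘ.mkℚᵘ (+ b) n ℚᵘ.+ ℚᵘ.mkℚᵘ (+ 1) k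
  unnormalised = ℚᵘ.*≤* (subst₂ ℤ._≤_ (ℤ.pos-* a (suc n * suc k)) rhs (ℤ.+≤+ cross))

-- With a ≤ (C/Q)(La + Q) and b ≥ (C/Q)(Lb − K), both errors are at most 1/(2k) once La ≥ 2Qk and Lb ≥ 2Kk.
cross-multiplied-bound : ∀ Q C K k La Lb a b .{{_ : NonZero Q}} →
  Q * a ≤ C * (La + Q) → C * Lb ≤ Q * b + C * K → C ≤ Q →
  Q * k + Q * k ≤ La → K * k + K * k ≤ Lb →
  a * (Lb * k) ≤ (b * k + 1 * Lb) * La
cross-multiplied-bound Q C K k La Lb a b upper lower C≤Q La≥ Lb≥ = *-cancelˡ-≤ Q (begin
  Q * (a * (Lb * k))                              ≡⟨ e₁ Q a Lb k ⟩
  (Q * a) * (Lb * k)                              ≤⟨ *-monoˡ-≤ (Lb * k) upper ⟩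
  C * (La + Q) * (Lb * k)                         ≡⟨ e₂ C La Q Lb k ⟩
  (C * Lb) * (La * k) + C * (Q * Lb * k)          ≤⟨ +-monoˡ-≤ _ (*-monoˡ-≤ (La * k) lower) ⟩
  (Q * b + C * K) * (La * k) + C * (Q * Lb * k)   ≡⟨ e₃ Q b C K La k Lb ⟩
  Q * b * La * k + C * error                      ≤⟨ +-monoʳ-≤ _ (*-mono-≤ C≤Q error≤) ⟩
  Q * b * La * k + Q * (La * Lb)                  ≡⟨ e₄ Q b La k Lb ⟩
  Q * ((b * k + 1 * Lb) * La)                     ∎)
  where
  open ≤-Reasoning
  error : ℕ
  error = K * La * k + Q * Lb * k
  e₁ : ∀ Q a Lb k → Q * (a * (Lb * k)) ≡ (Q * a) * (Lb * k)
  e₁ = solve-∀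
  e₂ : ∀ C La Q Lb k → C * (La + Q) * (Lb * k) ≡ (C * Lb) * (La * k) + C * (Q * Lb * k)
  e₂ = solve-∀
  e₃ : ∀ Q b C K La k Lb →
       (Q * b + C * K) * (La * k) + C * (Q * Lb * k) ≡ Q * b * La * k + C * (K * La * k + Q * Lb * k)
  e₃ = solve-∀
  e₄ : ∀ Q b La k Lb → Q * b * La * k + Q * (La * Lb) ≡ Q * ((b * k + 1 * Lb) * La)
  e₄ = solve-∀
  error≤ : error ≤ La * Lb
  error≤ = *-cancelˡ-≤ 2 (begin
    2 * error                                   ≡⟨ e₅ K La k Q Lb ⟩
    (K * k + K * k) * La + (Q * k + Q * k) * Lb ≤⟨ +-mono-≤ (*-monoˡ-≤ La Lb≥) (*-monoˡ-≤ Lb La≥) ⟩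
    Lb * La + La * Lb                           ≡⟨ e₆ La Lb ⟩
    2 * (La * Lb)                               ∎)
    where
    e₅ : ∀ K La k Q Lb → 2 * (K * La * k + Q * Lb * k) ≡ (K * k + K * k) * La + (Q * k + Q * k) * Lb
    e₅ = solve-∀
    e₆ : ∀ La Lb → Lb * La + La * Lb ≡ 2 * (La * Lb)
    e₆ = solve-∀

DensityLe-by-counting : ∀ {A B} Q C K .{{_ : NonZero Q}} → C ≤ Q →
  (∀ n → Q * count A n ≤ C * (suc (n + n) + Q)) →
  (∀ m → C * suc (m + m) ≤ Q * count B m + C * K) →
  DensityLe A B
DensityLe-by-counting {A} {B} Q C K C≤Q upper lower k = Q * suc k , bound
  where
  bound : ∀ n → Q * suc k ≤ n → ∀ M → ∃ λ m → M ≤ m × densitySeq A n ℚ.≤ densitySeq B m ℚ.+ + 1 ℚ./ suc k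
  bound n n≥ M = m , m≤m+n M _ ,
    a/[1+m]≤b/[1+n]+1/[1+k] (count A n) (count B m) (n + n) (m + m) k
      (cross-multiplied-bound Q C K (suc k) (suc (n + n)) (suc (m + m)) (count A n) (count B m)
        (upper n) (lower m) C≤Q (m≤n⇒m≤1+n (+-mono-≤ n≥ n≥)) (m≤n⇒m≤1+n (+-mono-≤ (m≤n+m _ M) (m≤n+m _ M))))
    where
    m : ℕ
    m = M + K * suc k

corollary6 : (S : List ℕ) → S ≢ [] → AllPos S → (r : ℕ) → 1 ≤ r →
    ∃ λ (A : Subset) → ∃ λ (p : ℕ) →
      IsPeriodic A p × p ≤ (6 * maxList S * r) * 2 ^ (6 * maxList S * r) ×
      IsIdCode S r A × (∀ (A′ : Subset) → IsIdCode S r A′ → DensityLe A A′)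
corollary6 S S≢[] S-pos r r≥1 =
  extend , Q , (s≤s z≤n , extend-periodic) , Q≤W*K , Local⇒IsIdCode extend-local ,
  λ A′ code → DensityLe-by-counting {extend} {A′} Q C K (ones≤ (sequence best) Q)
                count-extend≤ (code-counts code)
  where
  s∈S : maxList S ∈ S
  s∈S = maxList∈ S S≢[]
  open Locality S r
  open MinimumDensity W Local local? Local-resp (Local-all-true s∈S)
  open IntegerExtension (sequence best) Q (sequence-periodic best)

  extend-local : ∀ x → Local (window extend x)
  extend-local x = Local-resp (λ t _ → sym (extend-window x t)) (best-valid (residue x))

  W≥1 : 1 ≤ W
  W≥1 = *-mono-≤ (*-mono-≤ {1} {6} (s≤s z≤n) (S-pos s∈S)) r≥1

  Q≤W*K : Q ≤ W * K
  Q≤W*K = ≤-trans (period≤K best) (m≤n*m K W {{ℕ.>-nonZero W≥1}})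

  code-counts : ∀ {A′} → IsIdCode S r A′ → ∀ m → C * suc (m + m) ≤ Q * count A′ m + C * K
  code-counts {A′} code m = subst (λ c → C * suc (m + m) ≤ Q * c + C * K) (sym (count≡ones A′ m))
    (lower-bound (suc (m + m)) (λ t → A′ (+ t - + m)) (IsIdCode⇒Local-shifted code m))
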